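{- (1) If $n$ is a positive multiple of $4$, then $t(n+1)\neq t(n)$ and $t(n+2)\neq t(n)$. (2) If $n$ is a positive integer with $n\equiv2\pmod 4$, then [$t(n+1)\neq t(n)$ and $t(n+2)\neq t(n)$] holds if and only if the last (lowest-order) maximal block of consecutive ones in the binary expansion of $n$ has even length.
   Context: $t(m)\in\{0,1\}$ is the parity of the number of ones in the binary expansion of $m$. -}

module Defs where

open import Data.Nat using (ℕ; zero; suc; _+_; _*_; _%_; _/_)
open import Data.Bool using (Bool; true; false; _xor_)
open import Data.List using (List; []; _∷_)

-- Binary expansion of m, lowest-order bit first, no leading (high) zeros.
-- Uses a fuel argument (fuel ≥ m suffices since m / 2 < m for m > 0).
bitsFuel : ℕ → ℕ → List Bool
bitsFuel zero    m = []
bitsFuel (suc f) zero = []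
bitsFuel (suc f) (suc m) = (((suc m) % 2) Data.Nat.≡ᵇ 1) ∷ bitsFuel f ((suc m) / 2)

bits : ℕ → List Bool
bits m = bitsFuel m m

parity : List Bool → Bool
parity []       = false
parity (b ∷ bs) = b xor parity bs

-- Thue–Morse: t(m) = parity of the number of ones in binary expansion of m
-- (false ↔ 0, true ↔ 1)
t : ℕ → Bool
t m = parity (bits m)

runOnes : List Bool → ℕ
runOnes (true ∷ bs) = suc (runOnes bs)
runOnes _           = 0

lastBlockBits : List Bool → ℕ
lastBlockBits []           = 0
lastBlockBits (false ∷ bs) = lastBlockBits bs
lastBlockBits (true ∷ bs)  = suc (runOnes bs)

lastBlockLength : ℕ → ℕ
lastBlockLength m = lastBlockBits (bits m)

{-# OPTIONS --safe #-}
-- Writing n = 2j or n = 2j + 1 gives t(2j) = t(j) and t(2j + 1) = ¬ t(j). Going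
-- from k to k + 1 turns the r trailing ones of k into zeros and one zero into a
-- one, so t(k + 1) ≠ t(k) exactly when r is even. For n = 4k both n + 1 and
-- n + 2 have one more 1 than k. For n = 4k + 2 the value t(n + 1) = t(k) differs
-- from t(n) = ¬ t(k), while t(n + 2) = t(k + 1) differs from t(n) iff r is odd;
-- and the last block of ones of n = (k · 2 + 1) · 2 has length r + 1.
module Submission where

open import Defs
open import Data.Nat using (ℕ; zero; suc; _+_; _*_; _%_; _/_; _<_; _≤_; _≡ᵇ_; z≤n; s≤s)
open import Data.Nat.Properties using (≤-trans; ≤-refl; m≤m*n; +-comm; *-assoc)
open import Data.Nat.DivMod
  using (m≡m%n+[m/n]*n; m/n<m; m*n%n≡0; m*n/n≡m; [m+kn]%n≡m%n; +-distrib-/)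
open import Data.Nat.Induction using (<-rec)
open import Data.Bool using (Bool; true; false; not; _xor_)
open import Data.Bool.Properties using (not-involutive; not-injective; not-¬; xor-annihilates-not)
open import Data.List using (_∷_)
open import Data.Product using (_×_; _,_; proj₂)
open import Data.Empty using (⊥-elim)
open import Function.Bundles using (_⇔_; mk⇔)
open import Function.Properties.Equivalence using () renaming (refl to ⇔-refl; trans to ⇔-trans)
open import Relation.Binary.PropositionalEquality
  using (_≡_; _≢_; refl; sym; trans; cong; cong₂; subst; module ≡-Reasoning)
open ≡-Reasoning

≢-respects-≡ : ∀ {A : Set} {a a′ b b′ : A} →
                a ≡ a′ → b ≡ b′ → (a ≢ b) ⇔ (a′ ≢ b′)
≢-respects-≡ refl refl = ⇔-refl

xor-≢-not⇔≡false : ∀ b a → (b xor a ≢ not a) ⇔ (b ≡ false)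
xor-≢-not⇔≡false true  a = mk⇔ (λ h → ⊥-elim (h refl)) (λ ())
xor-≢-not⇔≡false false a = mk⇔ (λ _ → refl) (λ _ → not-¬ refl)

data Halving : ℕ → Set where
  even : ∀ j → Halving (j * 2)
  odd  : ∀ j → Halving (1 + j * 2)

halving : ∀ n → Halving n
halving zero = even 0
halving (suc n) with halving n
... | even j = odd j
... | odd j  = even (suc j)

suc-/2≤ : ∀ m → suc m / 2 ≤ m
suc-/2≤ m with m/n<m (suc m) 2 (s≤s (s≤s z≤n))
... | s≤s h = h

bitsFuel-irrelevant : ∀ f g m → m ≤ f → m ≤ g → bitsFuel f m ≡ bitsFuel g m
bitsFuel-irrelevant zero    zero    zero    _       _       = refl
bitsFuel-irrelevant zero    (suc g) zero    _       _       = refl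
bitsFuel-irrelevant (suc f) zero    zero    _       _       = refl
bitsFuel-irrelevant (suc f) (suc g) zero    _       _       = refl
bitsFuel-irrelevant (suc f) (suc g) (suc m) (s≤s m≤f) (s≤s m≤g) =
  cong (_ ∷_) (bitsFuel-irrelevant f g (suc m / 2)
                 (≤-trans (suc-/2≤ m) m≤f) (≤-trans (suc-/2≤ m) m≤g))

bits-suc : ∀ m → bits (suc m) ≡ (suc m % 2 ≡ᵇ 1) ∷ bits (suc m / 2)
bits-suc m = cong ((suc m % 2 ≡ᵇ 1) ∷_)
  (bitsFuel-irrelevant m (suc m / 2) (suc m / 2) (suc-/2≤ m) ≤-refl)

[1+j*2]/2≡j : ∀ j → (1 + j * 2) / 2 ≡ j
[1+j*2]/2≡j j = trans (+-distrib-/ 1 (j * 2) 1+0<2) (m*n/n≡m j 2)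
  where
  1+0<2 : 1 % 2 + j * 2 % 2 < 2
  1+0<2 = subst (λ r → 1 + r < 2) (sym (m*n%n≡0 j 2)) (s≤s (s≤s z≤n))

bits-double : ∀ j → bits (suc j * 2) ≡ false ∷ bits (suc j)
bits-double j = trans (bits-suc (suc (j * 2)))
  (cong₂ _∷_ (cong (_≡ᵇ 1) (m*n%n≡0 (suc j) 2)) (cong bits (m*n/n≡m (suc j) 2)))

bits-double+1 : ∀ j → bits (1 + j * 2) ≡ true ∷ bits j
bits-double+1 j = trans (bits-suc (j * 2))
  (cong₂ _∷_ (cong (_≡ᵇ 1) ([m+kn]%n≡m%n 1 j 2)) (cong bits ([1+j*2]/2≡j j)))

t-double : ∀ j → t (j * 2) ≡ t j
t-double zero    = refl
t-double (suc j) = cong parity (bits-double j)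

t-double+1 : ∀ j → t (1 + j * 2) ≡ not (t j)
t-double+1 j = cong parity (bits-double+1 j)

trailingOnes : ℕ → ℕ
trailingOnes k = runOnes (bits k)

trailingOnes-double : ∀ j → trailingOnes (j * 2) ≡ 0
trailingOnes-double zero    = refl
trailingOnes-double (suc j) = cong runOnes (bits-double j)

trailingOnes-double+1 : ∀ j → trailingOnes (1 + j * 2) ≡ suc (trailingOnes j)
trailingOnes-double+1 j = cong runOnes (bits-double+1 j)

isEven : ℕ → Bool
isEven zero    = true
isEven (suc n) = not (isEven n)

isEven⇔%2≡0 : ∀ n → isEven n ≡ true ⇔ n % 2 ≡ 0
isEven⇔%2≡0 zero          = mk⇔ (λ _ → refl) (λ _ → refl)
isEven⇔%2≡0 (suc zero)    = mk⇔ (λ ()) (λ ())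
isEven⇔%2≡0 (suc (suc n)) rewrite not-involutive (isEven n) = isEven⇔%2≡0 n

t-suc : ∀ k → t (suc k) ≡ isEven (trailingOnes k) xor t k
t-suc = <-rec _ step
  where
  step : ∀ k → (∀ {j} → j < k → t (suc j) ≡ isEven (trailingOnes j) xor t j) →
         t (suc k) ≡ isEven (trailingOnes k) xor t k
  step k ih with halving k
  ... | even j = begin
    t (1 + j * 2)
      ≡⟨ t-double+1 j ⟩
    not (t j)
      ≡⟨ cong not (t-double j) ⟨
    true xor t (j * 2)
      ≡⟨ cong (λ r → isEven r xor t (j * 2)) (trailingOnes-double j) ⟨
    isEven (trailingOnes (j * 2)) xor t (j * 2)
      ∎
  ... | odd j = begin
    t (suc j * 2)
      ≡⟨ t-double (suc j) ⟩
    t (suc j)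
      ≡⟨ ih (s≤s (m≤m*n j 2)) ⟩
    isEven (trailingOnes j) xor t j
      ≡⟨ xor-annihilates-not (isEven (trailingOnes j)) (t j) ⟨
    isEven (suc (trailingOnes j)) xor not (t j)
      ≡⟨ cong₂ (λ r a → isEven r xor a) (trailingOnes-double+1 j) (t-double+1 j) ⟨
    isEven (trailingOnes (1 + j * 2)) xor t (1 + j * 2)
      ∎

lastBlockLength-4k+2 : ∀ k → lastBlockLength ((1 + k * 2) * 2) ≡ suc (trailingOnes k)
lastBlockLength-4k+2 k rewrite bits-double (k * 2) | bits-double+1 k = refl

Isolated : ℕ → Set
Isolated n = (t (n + 1) ≢ t n) × (t (n + 2) ≢ t n)

t-double+1≢t-double : ∀ m → t (m * 2 + 1) ≢ t (m * 2)
t-double+1≢t-double m eq = not-¬ (t-double m) (begin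
  t (m * 2)      ≡⟨ sym eq ⟩
  t (m * 2 + 1)  ≡⟨ cong t (+-comm (m * 2) 1) ⟩
  t (1 + m * 2)  ≡⟨ t-double+1 m ⟩
  not (t m)      ∎)

isolated-4k : ∀ k → Isolated (k * 2 * 2)
isolated-4k k = t-double+1≢t-double (k * 2) , λ eq → not-¬ t[4k] (begin
  t (k * 2 * 2)      ≡⟨ sym eq ⟩
  t (k * 2 * 2 + 2)  ≡⟨ cong t (+-comm (k * 2 * 2) 2) ⟩
  t ((1 + k * 2) * 2) ≡⟨ t-double (1 + k * 2) ⟩
  t (1 + k * 2)      ≡⟨ t-double+1 k ⟩
  not (t k)          ∎)
  where
  t[4k] : t (k * 2 * 2) ≡ t k
  t[4k] = trans (t-double (k * 2)) (t-double k)

isolated-4k+2⇔odd-trailingOnes : ∀ k →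
  Isolated ((1 + k * 2) * 2) ⇔ isEven (trailingOnes k) ≡ false
isolated-4k+2⇔odd-trailingOnes k =
  ⇔-trans (mk⇔ proj₂ (t-double+1≢t-double (1 + k * 2) ,_))
    (⇔-trans (≢-respects-≡ t[n+2] t[n])
      (xor-≢-not⇔≡false (isEven (trailingOnes k)) (t k)))
  where
  n = (1 + k * 2) * 2
  t[n+2] : t (n + 2) ≡ isEven (trailingOnes k) xor t k
  t[n+2] = begin
    t (n + 2)          ≡⟨ cong t (+-comm n 2) ⟩
    t (suc k * 2 * 2)  ≡⟨ t-double (suc k * 2) ⟩
    t (suc k * 2)      ≡⟨ t-double (suc k) ⟩
    t (suc k)          ≡⟨ t-suc k ⟩
    isEven (trailingOnes k) xor t k ∎
  t[n] : t n ≡ not (t k)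
  t[n] = trans (t-double (1 + k * 2)) (t-double+1 k)

isolated-4k+2⇔lastBlock-even : ∀ k →
  Isolated ((1 + k * 2) * 2) ⇔ lastBlockLength ((1 + k * 2) * 2) % 2 ≡ 0
isolated-4k+2⇔lastBlock-even k =
  ⇔-trans (isolated-4k+2⇔odd-trailingOnes k)
    (⇔-trans (mk⇔ (cong not) not-injective)
      (subst (λ l → isEven (suc (trailingOnes k)) ≡ true ⇔ l % 2 ≡ 0)
        (sym (lastBlockLength-4k+2 k)) (isEven⇔%2≡0 (suc (trailingOnes k)))))

n≡r+[n/4]*2*2 : ∀ n {r} → n % 4 ≡ r → n ≡ r + n / 4 * 2 * 2
n≡r+[n/4]*2*2 n refl =
  trans (m≡m%n+[m/n]*n n 4) (cong (n % 4 +_) (sym (*-assoc (n / 4) 2 2)))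

lemma8 :
    ((n : ℕ) → 0 < n → n % 4 ≡ 0 → (t (n + 1) ≢ t n) × (t (n + 2) ≢ t n))
    × ((n : ℕ) → 0 < n → n % 4 ≡ 2 →
         (((t (n + 1) ≢ t n) × (t (n + 2) ≢ t n)) ⇔ (lastBlockLength n % 2 ≡ 0)))
lemma8 =
    (λ n _ n%4≡0 →
       subst Isolated (sym (n≡r+[n/4]*2*2 n n%4≡0)) (isolated-4k (n / 4)))
  , (λ n _ n%4≡2 →
       subst (λ m → Isolated m ⇔ lastBlockLength m % 2 ≡ 0) (sym (n≡r+[n/4]*2*2 n n%4≡2))
         (isolated-4k+2⇔lastBlock-even (n / 4)))
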